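{- Let $n\ge 3$ and let $s,t$ be indeterminates. Let $\mathfrak{D}_n^4$ be the set of $\pi\in\mathfrak{D}_n$ such that $\pi''\in\mathfrak{D}_{n-2}$, both $n$ and $n-1$ appear (with positive sign) among $\pi_1,\dots,\pi_n$, and their positions differ by more than $1$. Then $$\sum_{\pi\in\mathfrak{D}_n^4}(-1)^{\mathrm{inv}_D(\pi)}s^{\mathrm{asc}_B(\pi)}t^{\mathrm{des}_B(\pi)}=0.$$
   Context: $\mathfrak{B}_n$ is the group of signed permutations of $\{\pm1,\dots,\pm n\}$, written $\pi=\pi_1\cdots\pi_n$ with $\pi_i=\pi(i)$. $\mathrm{negs}(\pi)=|\{i:\pi_i<0\}|$; $\mathfrak{D}_n=\{\pi\in\mathfrak{B}_n:\mathrm{negs}(\pi)\text{ even}\}$. $\mathrm{inv}_D(\pi)=|\{i<j:\pi_i>\pi_j\}|+|\{i<j:-\pi_i>\pi_j\}|$. With $\pi_0=0$, $\mathrm{des}_B(\pi)=|\{i\in\{0,\dots,n-1\}:\pi_i>\pi_{i+1}\}|$ and $\mathrm{asc}_B(\pi)=n-\mathrm{des}_B(\pi)$. For $\pi\in\mathfrak{B}_n$, $\pi''\in\mathfrak{B}_{n-2}$ is the signed word obtained from $\pi_1\cdots\pi_n$ by deleting the two entries whose absolute values are $n$ and $n-1$. -}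

module Defs where

open import Level using (Level)
open import Data.Bool using (Bool; true; false; not; _∧_; _∨_; if_then_else_)
open import Data.Nat as ℕ using (ℕ; zero; suc; _∸_)
open import Data.Integer as ℤ using (ℤ; +_; -_; ∣_∣; 0ℤ)
open import Data.List using (List; []; _∷_; map; concatMap; length; filterᵇ; foldr; upTo)
open import Data.Maybe using (Maybe; just; nothing)
open import Relation.Nullary using (does)
open import Algebra.Bundles using (CommutativeRing)

-- Signed permutations of {±1,…,±n} as words π₁⋯πₙ of nonzero integers.

alphabet : ℕ → List ℤ
alphabet n = concatMap (λ i → + suc i ∷ - (+ suc i) ∷ []) (upTo n)

words : {A : Set} → List A → ℕ → List (List A)
words as zero    = [] ∷ []
words as (suc k) = concatMap (λ a → map (a ∷_) (words as k)) as

distinctAbs : List ℤ → Bool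
distinctAbs []       = true
distinctAbs (x ∷ xs) = notIn x xs ∧ distinctAbs xs
  where
  notIn : ℤ → List ℤ → Bool
  notIn x []       = true
  notIn x (y ∷ ys) = not (does (∣ x ∣ ℕ.≟ ∣ y ∣)) ∧ notIn x ys

Bn : ℕ → List (List ℤ)
Bn n = filterᵇ distinctAbs (words (alphabet n) n)

negs : List ℤ → ℕ
negs π = length (filterᵇ (λ x → does (x ℤ.<? 0ℤ)) π)

even : ℕ → Bool
even zero          = true
even (suc zero)    = false
even (suc (suc k)) = even k

inD : List ℤ → Bool
inD π = even (negs π)

invD : List ℤ → ℕ
invD []       = 0
invD (x ∷ xs) = length (filterᵇ (λ y → does (y ℤ.<? x)) xs)
              ℕ.+ length (filterᵇ (λ y → does (y ℤ.<? - x)) xs)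
              ℕ.+ invD xs

desWord : List ℤ → ℕ
desWord []           = 0
desWord (x ∷ [])     = 0
desWord (x ∷ y ∷ ys) = (if does (y ℤ.<? x) then 1 else 0) ℕ.+ desWord (y ∷ ys)

desB : List ℤ → ℕ
desB π = desWord (0ℤ ∷ π)

ascB : ℕ → List ℤ → ℕ
ascB n π = n ∸ desB π

dprime : ℕ → List ℤ → List ℤ
dprime n = filterᵇ (λ x → not (does (∣ x ∣ ℕ.≟ n)) ∧ not (does (∣ x ∣ ℕ.≟ n ∸ 1)))

position : ℤ → List ℤ → Maybe ℕ
position x []       = nothing
position x (y ∷ ys) with does (x ℤ.≟ y)
... | true  = just 1
... | false with position x ys
...   | just k  = just (suc k)
...   | nothing = nothing

farApart : ℕ → ℕ → Bool
farApart i j = does (1 ℕ.<? (i ∸ j)) ∨ does (1 ℕ.<? (j ∸ i))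

posFar : ℕ → List ℤ → Bool
posFar n π with position (+ n) π | position (+ (n ∸ 1)) π
... | just i | just j = farApart i j
... | _      | _      = false

inD4 : ℕ → List ℤ → Bool
inD4 n π = inD π ∧ inD (dprime n π) ∧ posFar n π

D4 : ℕ → List (List ℤ)
D4 n = filterᵇ (inD4 n) (Bn n)

-- The generating sum, evaluated in an arbitrary commutative ring.

module _ {c ℓ : Level} (R : CommutativeRing c ℓ) where
  open CommutativeRing R renaming (-_ to neg)

  pow : Carrier → ℕ → Carrier
  pow x zero    = 1#
  pow x (suc k) = x * pow x k

  signPow : ℕ → Carrier
  signPow k = if even k then 1# else neg 1#

  sumOver : {A : Set} → (A → Carrier) → List A → Carrier
  sumOver f = foldr (λ a r → f a + r) 0#

  D4Sum : ℕ → Carrier → Carrier → Carrier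
  D4Sum n s t = sumOver (λ π → signPow (invD π) * (pow s (ascB n π) * pow t (desB π))) (D4 n)

-- Exchanging the letters n and n − 1 (signs kept) is an involution σ of 𝔇ₙ⁴: in a member
-- both letters occur once, positively and non-adjacently, so σ merely swaps two entries,
-- which preserves negs, π'' and the distance between the two letters. Each adjacent pair
-- of 0π₁⋯πₙ contains a letter other than ±n, ±(n − 1), and such a letter compares with n
-- as it does with n − 1; hence des_B and asc_B are unchanged, while inv_D changes by
-- exactly one, coming from the pair {n, n − 1} itself. So σ reverses the sign of every
-- term and exchanges the words in which n precedes n − 1 with the others: the two halves
-- of the sum cancel, in any commutative ring.

module Submission where

open import Defs
open import Level using (Level)
open import Algebra.Bundles using (CommutativeRing)
open import Function using (_∘_; _⇔_; mk⇔; Equivalence)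
open import Data.Bool using (Bool; true; false; not; _∧_; if_then_else_; T; T?)
open import Data.Bool.Properties using (∧-zeroʳ; ∧-identityʳ; ∨-comm; T-∧; T-≡; if-eta; if-∧)
open import Data.Empty using (⊥-elim)
open import Data.Nat as ℕ using (ℕ; zero; suc; _≤_; s≤s)
import Data.Nat.Properties as ℕ
open import Data.Integer as ℤ using (ℤ; +_; -_; ∣_∣; 0ℤ; -[1+_]; +<+)
import Data.Integer.Properties as ℤ
open import Data.List using (List; []; _∷_; _++_; map; length; filterᵇ; concatMap; upTo; [_])
open import Data.Bool.ListAction using (all)
import Data.List.Properties as List
open import Data.List.Relation.Unary.All as All using (All; []; _∷_)
import Data.List.Relation.Unary.All.Properties as All
open import Data.List.Relation.Unary.AllPairs using (AllPairs; []; _∷_)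
open import Data.List.Relation.Unary.Linked as Linked using (Linked; []; [-]; _∷_)
open import Data.List.Relation.Binary.Permutation.Propositional
  using (_↭_; refl; prep; swap; trans; ↭-sym; ↭⇒↭ₛ)
open import Data.List.Relation.Binary.Permutation.Propositional.Properties
  using (shift; ++⁺ˡ; ↭-length; filter-↭)
import Data.List.Relation.Binary.Permutation.Setoid.Properties as Permutationₛ
open import Data.Maybe as Maybe using (Maybe; just; nothing)
open import Data.Product using (∃; ∃₂; _×_; _,_; proj₁; proj₂)
open import Data.Sum using (_⊎_; inj₁; inj₂)
open import Relation.Nullary using (Dec; yes; no; does; ¬_)
open import Relation.Nullary.Decidable
  using (dec-true; dec-false; does-⇔)
open import Relation.Binary.PropositionalEquality
  using (_≡_; _≢_; refl; sym; cong; cong₂; subst; ≢-sym; resp₂; module ≡-Reasoning)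
  renaming (trans to ≡-trans)
import Relation.Binary.PropositionalEquality as ≡

private
  variable
    A : Set
    p q : A → Bool
    xs ys : List A

T-not-does : ∀ {P : Set} (d : Dec P) → T (not (does d)) ⇔ (¬ P)
T-not-does (yes p)  = mk⇔ (λ ()) (λ ¬p → ¬p p)
T-not-does (no ¬p) = mk⇔ (λ _ → ¬p) (λ _ → _)

count : (A → Bool) → List A → ℕ
count p xs = length (filterᵇ p xs)

count-↭ : xs ↭ ys → count p xs ≡ count p ys
count-↭ {p = p} xs↭ys = ↭-length (filter-↭ (T? ∘ p) xs↭ys)

count-shift : ∀ (u : List A) x v → count p (u ++ x ∷ v) ≡ count p (x ∷ u ++ v)
count-shift u x v = count-↭ (shift x u v)

count-replace : ∀ (u : List A) {x y} v → p x ≡ p y → count p (u ++ x ∷ v) ≡ count p (u ++ y ∷ v)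
count-replace {p = p} u {x} {y} v e = begin
  count p (u ++ x ∷ v)  ≡⟨ count-shift u x v ⟩
  count p (x ∷ u ++ v)  ≡⟨ replace-head ⟩
  count p (y ∷ u ++ v)  ≡⟨ sym (count-shift u y v) ⟩
  count p (u ++ y ∷ v)  ∎
  where
  open ≡-Reasoning
  replace-head : count p (x ∷ u ++ v) ≡ count p (y ∷ u ++ v)
  replace-head rewrite e with p y
  ... | true  = refl
  ... | false = refl

filterᵇ-cong-local : All (λ z → p z ≡ q z) xs → filterᵇ p xs ≡ filterᵇ q xs
filterᵇ-cong-local [] = refl
filterᵇ-cong-local {q = q} {z ∷ _} (e ∷ es) rewrite e with q z
... | true  = cong (z ∷_) (filterᵇ-cong-local es)
... | false = filterᵇ-cong-local es

count-cong-local : All (λ z → p z ≡ q z) xs → count p xs ≡ count q xs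
count-cong-local = cong length ∘ filterᵇ-cong-local

swap-↭ : ∀ (a : List A) x b y c → a ++ x ∷ b ++ y ∷ c ↭ a ++ y ∷ b ++ x ∷ c
swap-↭ a x b y c =
  ++⁺ˡ a (trans (prep x (shift y b c)) (trans (swap x y refl) (prep y (↭-sym (shift x b c)))))

AllPairs-pivot : ∀ {R : A → A → Set} b {y c} → AllPairs R (b ++ y ∷ c) →
                 All (λ z → R z y) b × All (R y) c
AllPairs-pivot []      (Ry ∷ _)    = [] , Ry
AllPairs-pivot (z ∷ b) (Rz ∷ Rb) with AllPairs-pivot b Rb
... | Rby , Ryc = All.head (All.++⁻ʳ b Rz) ∷ Rby , Ryc

preserved-by-involution : {f : A → A} → (∀ x → f (f x) ≡ x) →
  (∀ x → T (p x) → T (p (f x))) → ∀ x → p (f x) ≡ p x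
preserved-by-involution {p = p} {f} f-inv pres x with p x in e | p (f x) in e′
... | true  | true  = refl
... | false | false = refl
... | true  | false = ⊥-elim (subst T e′ (pres x (subst T (sym e) _)))
... | false | true  = ⊥-elim (subst T e (subst (T ∘ p) (f-inv x) (pres (f x) (subst T (sym e′) _))))

-- Words over ℤ

AbsDistinct : List ℤ → Set
AbsDistinct = AllPairs (λ u v → ∣ u ∣ ≢ ∣ v ∣)

-- distinctAbs uses a where-bound helper that cannot be named here; Agda identifies its
-- instances for different outer arguments, which is what lets the induction hypothesis
-- be reused.
distinctAbs-∷ : ∀ x xs →
  distinctAbs (x ∷ xs) ≡ all (λ y → not (does (∣ x ∣ ℕ.≟ ∣ y ∣))) xs ∧ distinctAbs xs
distinctAbs-∷ x [] = refl
distinctAbs-∷ x (y ∷ ys) =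
  step (not (does (∣ x ∣ ℕ.≟ ∣ y ∣))) _ _ _ (distinctAbs ys) (distinctAbs-∷ x ys)
  where
  step : ∀ a h h′ hy d → h ∧ d ≡ h′ ∧ d → (a ∧ h) ∧ (hy ∧ d) ≡ (a ∧ h′) ∧ (hy ∧ d)
  step a h h′ hy false _ rewrite ∧-zeroʳ hy | ∧-zeroʳ (a ∧ h) | ∧-zeroʳ (a ∧ h′) = refl
  step a h h′ hy true  e = cong (λ b → (a ∧ b) ∧ (hy ∧ true))
                                (≡-trans (sym (∧-identityʳ h)) (≡-trans e (∧-identityʳ h′)))

distinctAbs⇒AbsDistinct : ∀ w → T (distinctAbs w) → AbsDistinct w
distinctAbs⇒AbsDistinct []       _ = []
distinctAbs⇒AbsDistinct (x ∷ xs) t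
  with Equivalence.to T-∧ (subst T (distinctAbs-∷ x xs) t)
... | tx , txs = All.map (λ {v} → Equivalence.to (T-not-does (∣ x ∣ ℕ.≟ ∣ v ∣))) (All.all⁺ _ xs tx)
               ∷ distinctAbs⇒AbsDistinct xs txs

AbsDistinct⇒distinctAbs : ∀ {w} → AbsDistinct w → T (distinctAbs w)
AbsDistinct⇒distinctAbs []                    = _
AbsDistinct⇒distinctAbs {x ∷ xs} (x∉xs ∷ dxs) = subst T (sym (distinctAbs-∷ x xs))
  (Equivalence.from T-∧ (All.all⁻ _ (All.map (λ {v} → Equivalence.from (T-not-does (∣ x ∣ ℕ.≟ ∣ v ∣))) x∉xs)
                        , AbsDistinct⇒distinctAbs dxs))

AbsDistinct-↭ : xs ↭ ys → AbsDistinct xs → AbsDistinct ys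
AbsDistinct-↭ xs↭ys = Permutationₛ.AllPairs-resp-↭ (≡.setoid ℤ) (λ p → p ∘ sym) (resp₂ _) (↭⇒↭ₛ xs↭ys)

desWord-map : ∀ (f : ℤ → ℤ) w → Linked (λ u v → does (f v ℤ.<? f u) ≡ does (v ℤ.<? u)) w →
              desWord (map f w) ≡ desWord w
desWord-map f []          []       = refl
desWord-map f (_ ∷ [])    [-]      = refl
desWord-map f (_ ∷ _ ∷ w) (e ∷ es) =
  cong₂ ℕ._+_ (cong (λ b → if b then 1 else 0) e) (desWord-map f (_ ∷ w) es)

position-∷ : ∀ x z w →
  position x (z ∷ w) ≡ (if does (x ℤ.≟ z) then just 1 else Maybe.map suc (position x w))
position-∷ x z w with does (x ℤ.≟ z)
... | true  = refl
... | false with position x w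
...   | just _  = refl
...   | nothing = refl

position-here : ∀ x w → position x (x ∷ w) ≡ just 1
position-here x w = ≡-trans (position-∷ x x w)
  (cong (λ b → if b then just 1 else Maybe.map suc (position x w)) (dec-true (x ℤ.≟ x) refl))

position-there : ∀ {x z} w → x ≢ z → position x (z ∷ w) ≡ Maybe.map suc (position x w)
position-there {x} {z} w x≢z =
  ≡-trans (position-∷ x z w)
          (cong (λ b → if b then _ else Maybe.map suc (position x w)) (dec-false (x ℤ.≟ z) x≢z))

position-absent : ∀ {x} w → All (x ≢_) w → position x w ≡ nothing
position-absent []      []           = refl
position-absent (_ ∷ w) (x≢z ∷ x∉w) =
  ≡-trans (position-there w x≢z) (cong (Maybe.map suc) (position-absent w x∉w))

position-split : ∀ {x} w {i} → position x w ≡ just i → ∃₂ λ b c → w ≡ b ++ x ∷ c × suc (length b) ≡ i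
position-split {x} (z ∷ w) {i} eq = go (x ℤ.≟ z) (≡-trans (sym (position-∷ x z w)) eq)
  where
  go : (d : Dec (x ≡ z)) → (if does d then just 1 else Maybe.map suc (position x w)) ≡ just i →
       ∃₂ λ b c → z ∷ w ≡ b ++ x ∷ c × suc (length b) ≡ i
  go (yes refl) refl = [] , w , refl , refl
  go (no _) e with position x w in pw
  go (no _) refl | just _ with position-split w pw
  ... | b , c , refl , refl = z ∷ b , c , refl , refl

position-map : ∀ {f : ℤ → ℤ} → (∀ z → f (f z) ≡ z) → ∀ x w → position x (map f w) ≡ position (f x) w
position-map f-inv x []      = refl
position-map {f} f-inv x (z ∷ w) = begin
  position x (f z ∷ map f w)
    ≡⟨ position-∷ x (f z) (map f w) ⟩
  (if does (x ℤ.≟ f z) then just 1 else Maybe.map suc (position x (map f w)))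
    ≡⟨ cong₂ (λ b r → if b then just 1 else Maybe.map suc r)
             (does-⇔ x≡fz⇔fx≡z (x ℤ.≟ f z) (f x ℤ.≟ z)) (position-map f-inv x w) ⟩
  (if does (f x ℤ.≟ z) then just 1 else Maybe.map suc (position (f x) w))
    ≡⟨ sym (position-∷ (f x) z w) ⟩
  position (f x) (z ∷ w) ∎
  where
  open ≡-Reasoning
  x≡fz⇔fx≡z : x ≡ f z ⇔ f x ≡ z
  x≡fz⇔fx≡z = mk⇔ (λ e → ≡-trans (cong f e) (f-inv z)) (λ e → ≡-trans (sym (f-inv x)) (cong f e))

apart : Maybe ℕ → Maybe ℕ → Bool
apart (just i) (just j) = farApart i j
apart _        _        = false

posFar-apart : ∀ n w → posFar n w ≡ apart (position (+ n) w) (position (+ (n ℕ.∸ 1)) w)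
posFar-apart n w with position (+ n) w | position (+ (n ℕ.∸ 1)) w
... | just _  | just _  = refl
... | just _  | nothing = refl
... | nothing | _       = refl

apart-comm : ∀ i j → apart i j ≡ apart j i
apart-comm (just i) (just j) = ∨-comm (does (1 ℕ.<? (i ℕ.∸ j))) _
apart-comm (just _) nothing  = refl
apart-comm nothing  (just _) = refl
apart-comm nothing  nothing  = refl

apart-suc : ∀ i j → apart (Maybe.map suc i) (Maybe.map suc j) ≡ apart i j
apart-suc (just _) (just _) = refl
apart-suc (just _) nothing  = refl
apart-suc nothing  _        = refl

apart-first : ∀ j → T (apart (just 1) (Maybe.map suc j)) → ∃ λ k → j ≡ just (suc (suc k))
apart-first (just (suc (suc k))) _ = k , refl
apart-first (just (suc zero))     ()
apart-first (just zero)           ()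
apart-first nothing               ()

alphabet-suc : ∀ p → alphabet (suc p) ≡ alphabet p ++ + suc p ∷ - + suc p ∷ []
alphabet-suc p = begin
  concatMap letters (upTo (suc p))         ≡⟨ cong (concatMap letters) (sym (List.upTo-∷ʳ p)) ⟩
  concatMap letters (upTo p ++ [ p ])      ≡⟨ List.concatMap-++ letters (upTo p) [ p ] ⟩
  alphabet p ++ letters p ++ []            ≡⟨ cong (alphabet p ++_) (List.++-identityʳ (letters p)) ⟩
  alphabet p ++ letters p                  ∎
  where
  open ≡-Reasoning
  letters : ℕ → List ℤ
  letters i = + suc i ∷ - + suc i ∷ []

alphabet-bounded : ∀ p → All (λ z → ∣ z ∣ ≤ p) (alphabet p)
alphabet-bounded zero = []
alphabet-bounded (suc p) rewrite alphabet-suc p =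
  All.++⁺ (All.map ℕ.m≤n⇒m≤1+n (alphabet-bounded p)) (ℕ.≤-refl ∷ ℕ.≤-refl ∷ [])

<-suc⇔< : ∀ {z a} → z ≢ a → z ℤ.< ℤ.suc a ⇔ z ℤ.< a
<-suc⇔< {z} {a} z≢a = mk⇔
  (λ z<sa → ℤ.≤∧≢⇒< (subst (z ℤ.≤_) (ℤ.pred-suc a) (ℤ.i<j⇒i≤pred[j] z<sa)) z≢a)
  (λ z<a → ℤ.<-≤-trans z<a (ℤ.i≤suc[i] a))

suc-<⇔< : ∀ {z a} → z ≢ ℤ.suc a → ℤ.suc a ℤ.< z ⇔ a ℤ.< z
suc-<⇔< {z} {a} z≢sa = mk⇔
  (ℤ.≤-<-trans (ℤ.i≤suc[i] a))
  (λ a<z → ℤ.≤∧≢⇒< (ℤ.i<j⇒suc[i]≤j a<z) (≢-sym z≢sa))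

below : ℤ → List ℤ → ℕ
below x = count (λ y → does (y ℤ.<? x))

below-∷-< : ∀ {x y} xs → y ℤ.< x → below x (y ∷ xs) ≡ suc (below x xs)
below-∷-< {x} {y} xs y<x rewrite dec-true (y ℤ.<? x) y<x = refl

below-∷-≮ : ∀ {x y} xs → ¬ y ℤ.< x → below x (y ∷ xs) ≡ below x xs
below-∷-≮ {x} {y} xs y≮x rewrite dec-false (y ℤ.<? x) y≮x = refl

-- Sums in a commutative ring

module Sums {c ℓ : Level} (R : CommutativeRing c ℓ) where

  open CommutativeRing R renaming (refl to ≈-refl; sym to ≈-sym; trans to ≈-trans; -_ to -ᵣ_)
  open import Algebra.Properties.Ring ring using (-0#≈0#; -‿involutive; -‿+-comm)
  open import Algebra.Properties.CommutativeSemigroup +-commutativeSemigroup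
    using (x∙yz≈y∙xz; interchange)
  open import Relation.Binary.Reasoning.Setoid setoid

  ∑ : (A → Carrier) → List A → Carrier
  ∑ = sumOver R

  sumOver-cong : ∀ {f g : A → Carrier} → (∀ x → f x ≈ g x) → ∀ xs → ∑ f xs ≈ ∑ g xs
  sumOver-cong f≈g []       = ≈-refl
  sumOver-cong f≈g (x ∷ xs) = +-cong (f≈g x) (sumOver-cong f≈g xs)

  sumOver-++ : ∀ (f : A → Carrier) xs ys → ∑ f (xs ++ ys) ≈ ∑ f xs + ∑ f ys
  sumOver-++ f []       ys = ≈-sym (+-identityˡ _)
  sumOver-++ f (x ∷ xs) ys = ≈-trans (+-congˡ (sumOver-++ f xs ys)) (≈-sym (+-assoc _ _ _))

  sumOver-concatMap : ∀ {B : Set} (f : B → Carrier) (g : A → List B) xs →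
                      ∑ f (concatMap g xs) ≈ ∑ (λ a → ∑ f (g a)) xs
  sumOver-concatMap f g []       = ≈-refl
  sumOver-concatMap f g (x ∷ xs) =
    ≈-trans (sumOver-++ f (g x) (concatMap g xs)) (+-congˡ (sumOver-concatMap f g xs))

  sumOver-map : ∀ {B : Set} (f : B → Carrier) (g : A → B) xs → ∑ f (map g xs) ≈ ∑ (f ∘ g) xs
  sumOver-map f g []       = ≈-refl
  sumOver-map f g (x ∷ xs) = +-congˡ (sumOver-map f g xs)

  sumOver-+ : ∀ (f g : A → Carrier) xs → ∑ (λ x → f x + g x) xs ≈ ∑ f xs + ∑ g xs
  sumOver-+ f g []       = ≈-sym (+-identityˡ _)
  sumOver-+ f g (x ∷ xs) = ≈-trans (+-congˡ (sumOver-+ f g xs)) (interchange _ _ _ _)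

  sumOver-neg : ∀ (f : A → Carrier) xs → ∑ (λ x → -ᵣ f x) xs ≈ -ᵣ ∑ f xs
  sumOver-neg f []       = ≈-sym -0#≈0#
  sumOver-neg f (x ∷ xs) = ≈-trans (+-congˡ (sumOver-neg f xs)) (-‿+-comm _ _)

  sumOver-filterᵇ : ∀ (f : A → Carrier) p xs → ∑ f (filterᵇ p xs) ≈ ∑ (λ x → if p x then f x else 0#) xs
  sumOver-filterᵇ f p []       = ≈-refl
  sumOver-filterᵇ f p (x ∷ xs) with p x
  ... | true  = +-congˡ (sumOver-filterᵇ f p xs)
  ... | false = ≈-trans (sumOver-filterᵇ f p xs) (≈-sym (+-identityˡ _))

  sumOver-↭ : ∀ (f : A → Carrier) → xs ↭ ys → ∑ f xs ≈ ∑ f ys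
  sumOver-↭ f refl         = ≈-refl
  sumOver-↭ f (prep x p)   = +-congˡ (sumOver-↭ f p)
  sumOver-↭ f (swap x y p) = ≈-trans (x∙yz≈y∙xz _ _ _) (+-congˡ (+-congˡ (sumOver-↭ f p)))
  sumOver-↭ f (trans p q)  = ≈-trans (sumOver-↭ f p) (sumOver-↭ f q)

  sumOver-words-map : ∀ {τ : A → A} {as} → map τ as ↭ as →
                      ∀ k (F : List A → Carrier) → ∑ (F ∘ map τ) (words as k) ≈ ∑ F (words as k)
  sumOver-words-map           τ↭ zero    F = ≈-refl
  sumOver-words-map {τ = τ} {as} τ↭ (suc k) F = begin
    ∑ (F ∘ map τ) (concatMap (λ a → map (a ∷_) (words as k)) as)
      ≈⟨ sumOver-concatMap _ _ as ⟩
    ∑ (λ a → ∑ (F ∘ map τ) (map (a ∷_) (words as k))) as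
      ≈⟨ sumOver-cong (λ a → sumOver-map _ (a ∷_) (words as k)) as ⟩
    ∑ (λ a → ∑ (λ w → F (τ a ∷ map τ w)) (words as k)) as
      ≈⟨ sumOver-cong (λ a → sumOver-words-map τ↭ k (λ w → F (τ a ∷ w))) as ⟩
    ∑ (λ a → ∑ (λ w → F (τ a ∷ w)) (words as k)) as
      ≈⟨ ≈-sym (sumOver-map (λ b → ∑ (λ w → F (b ∷ w)) (words as k)) τ as) ⟩
    ∑ (λ b → ∑ (λ w → F (b ∷ w)) (words as k)) (map τ as)
      ≈⟨ sumOver-↭ _ τ↭ ⟩
    ∑ (λ a → ∑ (λ w → F (a ∷ w)) (words as k)) as
      ≈⟨ sumOver-cong (λ a → ≈-sym (sumOver-map F (a ∷_) (words as k))) as ⟩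
    ∑ (λ a → ∑ F (map (a ∷_) (words as k))) as
      ≈⟨ ≈-sym (sumOver-concatMap F _ as) ⟩
    ∑ F (words as (suc k)) ∎

  sumOver-signReversing :
    ∀ {A : Set} (W : List A) (σ : A → A) (p first : A → Bool) (t : A → Carrier) →
    (∀ F → ∑ (F ∘ σ) W ≈ ∑ F W) →
    (∀ w → p (σ w) ≡ p w) →
    (∀ w → p w ≡ true → first (σ w) ≡ not (first w)) →
    (∀ w → p w ≡ true → t (σ w) ≈ -ᵣ t w) →
    ∑ (λ w → if p w then t w else 0#) W ≈ 0#
  sumOver-signReversing {A} W σ p first t σ-perm p-σ first-σ t-σ = begin
    ∑ h W                        ≈⟨ sumOver-cong split W ⟩
    ∑ (λ w → hA w + hB w) W      ≈⟨ sumOver-+ hA hB W ⟩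
    ∑ hA W + ∑ hB W              ≈⟨ +-congʳ (≈-sym (σ-perm hA)) ⟩
    ∑ (hA ∘ σ) W + ∑ hB W        ≈⟨ +-congʳ (≈-trans (sumOver-cong paired W) (sumOver-neg hB W)) ⟩
    -ᵣ ∑ hB W + ∑ hB W           ≈⟨ -‿inverseˡ _ ⟩
    0#                           ∎
    where
    h hA hB : A → Carrier
    h  w = if p w then t w else 0#
    hA w = if first w then h w else 0#
    hB w = if first w then 0# else h w
    split : ∀ w → h w ≈ hA w + hB w
    split w with first w
    ... | true  = ≈-sym (+-identityʳ _)
    ... | false = ≈-sym (+-identityˡ _)
    paired : ∀ w → hA (σ w) ≈ -ᵣ hB w
    paired w with p w in e
    ... | true  rewrite p-σ w | e | first-σ w e with first w
    ...   | true  = ≈-sym -0#≈0#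
    ...   | false = t-σ w e
    paired w | false rewrite p-σ w | e =
      ≈-trans (reflexive (if-eta (first (σ w))))
              (≈-trans (≈-sym -0#≈0#) (-‿cong (reflexive (sym (if-eta (first w))))))

  even-suc : ∀ k → even (suc k) ≡ not (even k)
  even-suc zero          = refl
  even-suc (suc zero)    = refl
  even-suc (suc (suc k)) = even-suc k

  signPow-suc : ∀ k → signPow R (suc k) ≈ -ᵣ signPow R k
  signPow-suc k rewrite even-suc k with even k
  ... | true  = ≈-refl
  ... | false = ≈-sym (-‿involutive 1#)

  signPow-adjacent : ∀ {i j} → i ≡ suc j ⊎ j ≡ suc i → signPow R j ≈ -ᵣ signPow R i
  signPow-adjacent {j = j} (inj₁ refl) = ≈-sym (≈-trans (-‿cong (signPow-suc j)) (-‿involutive _))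
  signPow-adjacent {i = i} (inj₂ refl) = signPow-suc i

-- Exchanging the letters n and n - 1

module Transposition (m : ℕ) where

  n : ℕ
  n = suc (suc m)

  N M : ℤ
  N = + n
  M = + suc m

  M<N : M ℤ.< N
  M<N = +<+ ℕ.≤-refl

  M≢N : M ≢ N
  M≢N = ℤ.<⇒≢ M<N

  record Clean (z : ℤ) : Set where
    constructor clean
    field
      ≢n : ∣ z ∣ ≢ n
      ≢m : ∣ z ∣ ≢ suc m

  data Letter : ℤ → Set where
    isN     : Letter N
    isM     : Letter M
    is-N    : Letter (- N)
    is-M    : Letter (- M)
    isClean : ∀ {z} → Clean z → Letter z

  letter : ∀ z → Letter z
  letter z with ∣ z ∣ ℕ.≟ n | ∣ z ∣ ℕ.≟ suc m
  letter (+ _)    | yes refl | _        = isN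
  letter -[1+ _ ] | yes refl | _        = is-N
  letter (+ _)    | no _     | yes refl = isM
  letter -[1+ _ ] | no _     | yes refl = is-M
  letter _        | no ≢n    | no ≢m    = isClean (clean ≢n ≢m)

  clean⇒≢N : ∀ {z} → Clean z → z ≢ N
  clean⇒≢N (clean ≢n _) = ≢n ∘ cong ∣_∣

  clean⇒≢M : ∀ {z} → Clean z → z ≢ M
  clean⇒≢M (clean _ ≢m) = ≢m ∘ cong ∣_∣

  clean⇒≢-N : ∀ {z} → Clean z → z ≢ - N
  clean⇒≢-N (clean ≢n _) = ≢n ∘ cong ∣_∣

  clean-neg : ∀ {z} → Clean z → Clean (- z)
  clean-neg {z} (clean ≢n ≢m) = clean (≢n ∘ ≡-trans ∣-z∣≡∣z∣) (≢m ∘ ≡-trans ∣-z∣≡∣z∣)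
    where
    ∣-z∣≡∣z∣ : ∣ z ∣ ≡ ∣ - z ∣
    ∣-z∣≡∣z∣ = sym (ℤ.∣-i∣≡∣i∣ z)

  clean-0 : Clean 0ℤ
  clean-0 = clean (λ ()) (λ ())

  τ : ℤ → ℤ
  τ z = if does (z ℤ.≟ N) then M else if does (z ℤ.≟ M) then N else z

  τ-N : τ N ≡ M
  τ-N rewrite dec-true (N ℤ.≟ N) refl = refl

  τ-M : τ M ≡ N
  τ-M rewrite dec-false (M ℤ.≟ N) M≢N | dec-true (M ℤ.≟ M) refl = refl

  τ-fix : ∀ {z} → z ≢ N → z ≢ M → τ z ≡ z
  τ-fix {z} z≢N z≢M rewrite dec-false (z ℤ.≟ N) z≢N | dec-false (z ℤ.≟ M) z≢M = refl

  τ-clean : ∀ {z} → Clean z → τ z ≡ z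
  τ-clean c = τ-fix (clean⇒≢N c) (clean⇒≢M c)

  τ-negative : ∀ k → τ -[1+ k ] ≡ -[1+ k ]
  τ-negative k = τ-fix (λ ()) (λ ())

  τ-involutive : ∀ z → τ (τ z) ≡ z
  τ-involutive z with letter z
  ... | isN       = ≡-trans (cong τ τ-N) τ-M
  ... | isM       = ≡-trans (cong τ τ-M) τ-N
  ... | is-N      = ≡-trans (cong τ (τ-negative (suc m))) (τ-negative (suc m))
  ... | is-M      = ≡-trans (cong τ (τ-negative m)) (τ-negative m)
  ... | isClean c = ≡-trans (cong τ (τ-clean c)) (τ-clean c)

  σ : List ℤ → List ℤ
  σ = map τ

  σ-involutive : ∀ w → σ (σ w) ≡ w
  σ-involutive w =
    ≡-trans (sym (List.map-∘ w)) (≡-trans (List.map-cong τ-involutive w) (List.map-id w))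

  σ-clean : ∀ {a} → All Clean a → σ a ≡ a
  σ-clean ca = List.map-id-local (All.map τ-clean ca)

  -- N and - M compute to ℤ.suc M and ℤ.suc (- N).
  <N≡<M : ∀ {z} → z ≢ M → does (z ℤ.<? N) ≡ does (z ℤ.<? M)
  <N≡<M {z} z≢M = does-⇔ (<-suc⇔< {a = M} z≢M) (z ℤ.<? N) (z ℤ.<? M)

  N<≡M< : ∀ {z} → z ≢ N → does (N ℤ.<? z) ≡ does (M ℤ.<? z)
  N<≡M< {z} z≢N = does-⇔ (suc-<⇔< {a = M} z≢N) (N ℤ.<? z) (M ℤ.<? z)

  <-M≡<-N : ∀ {z} → z ≢ - N → does (z ℤ.<? - M) ≡ does (z ℤ.<? - N)
  <-M≡<-N {z} z≢-N = does-⇔ (<-suc⇔< {a = - N} z≢-N) (z ℤ.<? - M) (z ℤ.<? - N)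

  M<≡N< : ∀ {z} → Clean z → does (M ℤ.<? z) ≡ does (N ℤ.<? z)
  M<≡N< cz = sym (N<≡M< (clean⇒≢N cz))

  τ-<ʳ : ∀ {u} → Clean u → ∀ v → does (τ v ℤ.<? u) ≡ does (v ℤ.<? u)
  τ-<ʳ cu v with letter v
  ... | isN       rewrite τ-N              = M<≡N< cu
  ... | isM       rewrite τ-M              = sym (M<≡N< cu)
  ... | is-N      rewrite τ-negative (suc m) = refl
  ... | is-M      rewrite τ-negative m       = refl
  ... | isClean c rewrite τ-clean c        = refl

  τ-<ˡ : ∀ {v} → Clean v → ∀ u → does (v ℤ.<? τ u) ≡ does (v ℤ.<? u)
  τ-<ˡ cv u with letter u
  ... | isN       rewrite τ-N              = sym (<N≡<M (clean⇒≢M cv))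
  ... | isM       rewrite τ-M              = <N≡<M (clean⇒≢M cv)
  ... | is-N      rewrite τ-negative (suc m) = refl
  ... | is-M      rewrite τ-negative m       = refl
  ... | isClean c rewrite τ-clean c        = refl

  OneClean : ℤ → ℤ → Set
  OneClean u v = Clean u ⊎ Clean v

  τ-< : ∀ {u v} → OneClean u v → does (τ v ℤ.<? τ u) ≡ does (v ℤ.<? u)
  τ-< {v = v} (inj₁ cu) rewrite τ-clean cu = τ-<ʳ cu v
  τ-< {u = u} (inj₂ cv) rewrite τ-clean cv = τ-<ˡ cv u

  linked-∷ : ∀ {z w} → Clean z → Linked OneClean w → Linked OneClean (z ∷ w)
  linked-∷ {w = []}    cz _ = [-]
  linked-∷ {w = _ ∷ _} cz l = inj₁ cz ∷ l

  linked-++ : ∀ {a w} → All Clean a → Linked OneClean w → Linked OneClean (a ++ w)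
  linked-++ []        l = l
  linked-++ (cz ∷ ca) l = linked-∷ cz (linked-++ ca l)

  linked-before : ∀ {z w} → All Clean w → Linked OneClean (z ∷ w)
  linked-before []        = [-]
  linked-before (cv ∷ cw) = inj₂ cv ∷ linked-before cw

  data Order : ℤ → ℤ → Set where
    N-first : Order N M
    M-first : Order M N

  τ-order : ∀ {x y} → Order x y → τ x ≡ y × τ y ≡ x
  τ-order N-first = τ-N , τ-M
  τ-order M-first = τ-M , τ-N

  clean-between : ∀ {x y z} → Order x y → ∣ x ∣ ≢ ∣ z ∣ → ∣ z ∣ ≢ ∣ y ∣ → Clean z
  clean-between N-first x≢z z≢y = clean (≢-sym x≢z) z≢y
  clean-between M-first x≢z z≢y = clean z≢y (≢-sym x≢z)

  record Separated (w : List ℤ) : Set where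
    constructor separation
    field
      x y     : ℤ
      order   : Order x y
      a       : List ℤ
      b₀      : ℤ
      b c     : List ℤ
      shape   : w ≡ a ++ x ∷ b₀ ∷ b ++ y ∷ c
      clean-a : All Clean a
      clean-b : All Clean (b₀ ∷ b)
      clean-c : All Clean c

  separated-∷ : ∀ {z w} → Clean z → Separated w → Separated (z ∷ w)
  separated-∷ {z} cz s =
    separation x y order (z ∷ a) b₀ b c (cong (z ∷_) shape) (cz ∷ clean-a) clean-b clean-c
    where open Separated s

  separated-from : ∀ {x y w} → Order x y → All (λ v → ∣ x ∣ ≢ ∣ v ∣) w → AbsDistinct w →
                   T (apart (just 1) (Maybe.map suc (position y w))) → Separated (x ∷ w)
  separated-from {x} {y} {w} o x∉w dw far with apart-first (position y w) far
  ... | k , pos with position-split w pos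
  ... | [] , c , _ , ()
  ... | b₀ ∷ b , c , refl , _ with AllPairs-pivot (b₀ ∷ b) dw
  ...   | b≢y , y≢c = separation x y o [] b₀ b c refl []
    (All.zipWith (λ (x≢v , v≢y) → clean-between o x≢v v≢y) (All.++⁻ˡ (b₀ ∷ b) x∉w , b≢y))
    (All.zipWith (λ (x≢v , y≢v) → clean-between o x≢v (≢-sym y≢v))
                 (All.tail (All.++⁻ʳ (b₀ ∷ b) x∉w) , y≢c))

  NM-apart : List ℤ → Bool
  NM-apart w = apart (position N w) (position M w)

  NM-apart-clean : ∀ {z} w → Clean z → NM-apart (z ∷ w) ≡ NM-apart w
  NM-apart-clean w cz = ≡-trans
    (cong₂ apart (position-there w (≢-sym (clean⇒≢N cz))) (position-there w (≢-sym (clean⇒≢M cz))))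
    (apart-suc (position N w) (position M w))

  NM-apart-N : ∀ w → NM-apart (N ∷ w) ≡ apart (just 1) (Maybe.map suc (position M w))
  NM-apart-N w = cong₂ apart (position-here N w) (position-there w M≢N)

  NM-apart-M : ∀ w → NM-apart (M ∷ w) ≡ apart (just 1) (Maybe.map suc (position N w))
  NM-apart-M w = ≡-trans (apart-comm (position N (M ∷ w)) _)
                         (cong₂ apart (position-here M w) (position-there w (≢-sym M≢N)))

  NM-apart-−N : ∀ w → All (λ v → n ≢ ∣ v ∣) w → NM-apart (- N ∷ w) ≡ false
  NM-apart-−N w n∉w = cong (λ i → apart i (position M (- N ∷ w)))
    (position-absent {N} (- N ∷ w) ((λ ()) ∷ All.map (_∘ cong ∣_∣) n∉w))

  NM-apart-−M : ∀ w → All (λ v → suc m ≢ ∣ v ∣) w → NM-apart (- M ∷ w) ≡ false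
  NM-apart-−M w m∉w = ≡-trans
    (cong (apart (position N (- M ∷ w))) (position-absent {M} (- M ∷ w) ((λ ()) ∷ All.map (_∘ cong ∣_∣) m∉w)))
    (apart-comm (position N (- M ∷ w)) nothing)

  separated : ∀ w → AbsDistinct w → T (NM-apart w) → Separated w
  separated []      _            ()
  separated (z ∷ w) (z∉w ∷ dw) far with letter z
  ... | isClean cz = separated-∷ cz (separated w dw (subst T (NM-apart-clean w cz) far))
  ... | isN        = separated-from N-first z∉w dw (subst T (NM-apart-N w) far)
  ... | isM        = separated-from M-first z∉w dw (subst T (NM-apart-M w) far)
  ... | is-N       = ⊥-elim (subst T (NM-apart-−N w z∉w) far)
  ... | is-M       = ⊥-elim (subst T (NM-apart-−M w z∉w) far)

  σ-swap : ∀ {x y} a {b c} → Order x y → All Clean a → All Clean b → All Clean c →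
           σ (a ++ x ∷ b ++ y ∷ c) ≡ a ++ y ∷ b ++ x ∷ c
  σ-swap {x} {y} a {b} {c} o ca cb cc
    rewrite List.map-++ τ a (x ∷ b ++ y ∷ c) | List.map-++ τ b (y ∷ c)
          | σ-clean ca | σ-clean cb | σ-clean cc | proj₁ (τ-order o) | proj₂ (τ-order o) = refl

  σ-↭ : ∀ {w} → Separated w → σ w ↭ w
  σ-↭ (separation x y o a b₀ b c refl ca cb cc)
    rewrite σ-swap a o ca cb cc = swap-↭ a y (b₀ ∷ b) x c

  below-N≡below-M : ∀ {xs} → All Clean xs → below N xs ≡ below M xs
  below-N≡below-M cs = count-cong-local (All.map (<N≡<M ∘ clean⇒≢M) cs)

  below-−N≡below-−M : ∀ {xs} → All Clean xs → below (- N) xs ≡ below (- M) xs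
  below-−N≡below-−M cs = sym (count-cong-local (All.map (<-M≡<-N ∘ clean⇒≢-N) cs))

  invD-replace : ∀ b {c} → All Clean b → All Clean c → invD (b ++ M ∷ c) ≡ invD (b ++ N ∷ c)
  invD-replace [] {c} cb cc =
    cong (ℕ._+ invD c) (cong₂ ℕ._+_ (sym (below-N≡below-M cc)) (sym (below-−N≡below-−M cc)))
  invD-replace (z ∷ b) (cz ∷ cb) cc = cong₂ ℕ._+_
    (cong₂ ℕ._+_ (count-replace b _ (M<≡N< cz)) (count-replace b _ (M<≡N< (clean-neg cz))))
    (invD-replace b cb cc)

  invD-swap-head : ∀ {b c} → All Clean b → All Clean c →
                   invD (N ∷ b ++ M ∷ c) ≡ suc (invD (M ∷ b ++ N ∷ c))
  invD-swap-head {b} {c} cb cc = cong₂ ℕ._+_ (cong₂ ℕ._+_ below-N below-−N) (invD-replace b cb cc)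
    where
    open ≡-Reasoning
    cbc : All Clean (b ++ c)
    cbc = All.++⁺ cb cc
    below-N : below N (b ++ M ∷ c) ≡ suc (below M (b ++ N ∷ c))
    below-N = begin
      below N (b ++ M ∷ c)        ≡⟨ count-shift b M c ⟩
      below N (M ∷ b ++ c)        ≡⟨ below-∷-< (b ++ c) M<N ⟩
      suc (below N (b ++ c))      ≡⟨ cong suc (below-N≡below-M cbc) ⟩
      suc (below M (b ++ c))      ≡⟨ cong suc (sym (below-∷-≮ (b ++ c) (ℤ.<-asym M<N))) ⟩
      suc (below M (N ∷ b ++ c))  ≡⟨ cong suc (sym (count-shift b N c)) ⟩
      suc (below M (b ++ N ∷ c))  ∎
    below-−N : below (- N) (b ++ M ∷ c) ≡ below (- M) (b ++ N ∷ c)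
    below-−N = begin
      below (- N) (b ++ M ∷ c)    ≡⟨ count-shift b M c ⟩
      below (- N) (M ∷ b ++ c)    ≡⟨ below-∷-≮ {y = M} (b ++ c) (λ ()) ⟩
      below (- N) (b ++ c)        ≡⟨ below-−N≡below-−M cbc ⟩
      below (- M) (b ++ c)        ≡⟨ sym (below-∷-≮ {y = N} (b ++ c) (λ ())) ⟩
      below (- M) (N ∷ b ++ c)    ≡⟨ sym (count-shift b N c) ⟩
      below (- M) (b ++ N ∷ c)    ∎

  invD-swap : ∀ a {b c} → All Clean b → All Clean c →
              invD (a ++ N ∷ b ++ M ∷ c) ≡ suc (invD (a ++ M ∷ b ++ N ∷ c))
  invD-swap []      cb cc = invD-swap-head cb cc
  invD-swap (z ∷ a) {b} {c} cb cc = ≡-trans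
    (cong₂ ℕ._+_ (cong₂ ℕ._+_ (count-↭ swapped) (count-↭ swapped)) (invD-swap a cb cc))
    (ℕ.+-suc _ _)
    where
    swapped : a ++ N ∷ b ++ M ∷ c ↭ a ++ M ∷ b ++ N ∷ c
    swapped = swap-↭ a N b M c

  invD-σ : ∀ {w} → Separated w → invD w ≡ suc (invD (σ w)) ⊎ invD (σ w) ≡ suc (invD w)
  invD-σ (separation _ _ N-first a b₀ b c refl ca cb cc)
    rewrite σ-swap a N-first ca cb cc = inj₁ (invD-swap a cb cc)
  invD-σ (separation _ _ M-first a b₀ b c refl ca cb cc)
    rewrite σ-swap a M-first ca cb cc = inj₂ (invD-swap a cb cc)

  separated-linked : ∀ {w} → Separated w → Linked OneClean (0ℤ ∷ w)
  separated-linked (separation _ _ _ a _ _ _ refl ca (cb₀ ∷ cb) cc) =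
    linked-∷ clean-0 (linked-++ ca (inj₂ cb₀ ∷ linked-++ (cb₀ ∷ cb) (linked-before cc)))

  desB-σ : ∀ {w} → Separated w → desB (σ w) ≡ desB w
  desB-σ {w} s = ≡-trans (cong (λ z → desWord (z ∷ σ w)) (sym (τ-clean clean-0)))
                         (desWord-map τ (0ℤ ∷ w) (Linked.map τ-< (separated-linked s)))

  NbeforeM : List ℤ → Bool
  NbeforeM []      = false
  NbeforeM (z ∷ w) = if does (z ℤ.≟ N) then true else if does (z ℤ.≟ M) then false else NbeforeM w

  NbeforeM-N : ∀ {a} r → All Clean a → NbeforeM (a ++ N ∷ r) ≡ true
  NbeforeM-N r [] rewrite dec-true (N ℤ.≟ N) refl = refl
  NbeforeM-N r (_∷_ {z} cz ca)
    rewrite dec-false (z ℤ.≟ N) (clean⇒≢N cz) | dec-false (z ℤ.≟ M) (clean⇒≢M cz) = NbeforeM-N r ca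

  NbeforeM-M : ∀ {a} r → All Clean a → NbeforeM (a ++ M ∷ r) ≡ false
  NbeforeM-M r [] rewrite dec-false (M ℤ.≟ N) M≢N | dec-true (M ℤ.≟ M) refl = refl
  NbeforeM-M r (_∷_ {z} cz ca)
    rewrite dec-false (z ℤ.≟ N) (clean⇒≢N cz) | dec-false (z ℤ.≟ M) (clean⇒≢M cz) = NbeforeM-M r ca

  NbeforeM-σ : ∀ {w} → Separated w → NbeforeM (σ w) ≡ not (NbeforeM w)
  NbeforeM-σ (separation _ _ N-first a b₀ b c refl ca cb cc) rewrite σ-swap a N-first ca cb cc
    | NbeforeM-M (b₀ ∷ b ++ N ∷ c) ca | NbeforeM-N (b₀ ∷ b ++ M ∷ c) ca = refl
  NbeforeM-σ (separation _ _ M-first a b₀ b c refl ca cb cc) rewrite σ-swap a M-first ca cb cc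
    | NbeforeM-N (b₀ ∷ b ++ M ∷ c) ca | NbeforeM-M (b₀ ∷ b ++ N ∷ c) ca = refl

  posFar-σ : ∀ w → posFar n (σ w) ≡ posFar n w
  posFar-σ w = begin
    posFar n (σ w)                          ≡⟨ posFar-apart n (σ w) ⟩
    NM-apart (σ w)                          ≡⟨ cong₂ apart (position-σ N τ-N) (position-σ M τ-M) ⟩
    apart (position M w) (position N w)     ≡⟨ apart-comm (position M w) _ ⟩
    NM-apart w                              ≡⟨ sym (posFar-apart n w) ⟩
    posFar n w                              ∎
    where
    open ≡-Reasoning
    position-σ : ∀ x {y} → τ x ≡ y → position x (σ w) ≡ position y w
    position-σ x refl = position-map τ-involutive x w

  isD4 : List ℤ → Bool
  isD4 w = distinctAbs w ∧ inD4 n w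

  isD4⇒ : ∀ w → T (isD4 w) → T (distinctAbs w) × T (inD w) × T (inD (dprime n w)) × T (posFar n w)
  isD4⇒ _ t with Equivalence.to T-∧ t
  ... | d , t′ with Equivalence.to T-∧ t′
  ...   | i , t″ with Equivalence.to T-∧ t″
  ...     | i′ , f = d , i , i′ , f

  isD4⇐ : ∀ w → T (distinctAbs w) → T (inD w) → T (inD (dprime n w)) → T (posFar n w) → T (isD4 w)
  isD4⇐ _ d i i′ f = Equivalence.from T-∧ (d , Equivalence.from T-∧ (i , Equivalence.from T-∧ (i′ , f)))

  separated-isD4 : ∀ w → T (isD4 w) → Separated w
  separated-isD4 w t with isD4⇒ w t
  ... | d , _ , _ , f = separated w (distinctAbs⇒AbsDistinct w d) (subst T (posFar-apart n w) f)

  isD4-σ : ∀ w → T (isD4 w) → T (isD4 (σ w))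
  isD4-σ w t with isD4⇒ w t
  ... | d , i , i′ , f = isD4⇐ (σ w)
    (AbsDistinct⇒distinctAbs (AbsDistinct-↭ (↭-sym σw↭w) (distinctAbs⇒AbsDistinct w d)))
    (subst T (cong even (sym (count-↭ σw↭w))) i)
    (subst T (cong even (sym (count-↭ (filter-↭ _ σw↭w)))) i′)
    (subst T (sym (posFar-σ w)) f)
    where
    σw↭w : σ w ↭ w
    σw↭w = σ-↭ (separated-isD4 w t)

  alphabet-n : alphabet n ≡ alphabet m ++ M ∷ - M ∷ N ∷ - N ∷ []
  alphabet-n = ≡-trans (alphabet-suc (suc m))
    (≡-trans (cong (_++ N ∷ - N ∷ []) (alphabet-suc m)) (List.++-assoc (alphabet m) (M ∷ - M ∷ []) _))

  alphabet-m-clean : All Clean (alphabet m)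
  alphabet-m-clean =
    All.map (λ ≤m → clean (ℕ.<⇒≢ (ℕ.m<n⇒m<1+n (s≤s ≤m))) (ℕ.<⇒≢ (s≤s ≤m))) (alphabet-bounded m)

  σ-alphabet : σ (alphabet n) ↭ alphabet n
  σ-alphabet =
    ≡.subst₂ _↭_ (sym σ-alphabet-n) (sym alphabet-n) (swap-↭ (alphabet m) N [ - M ] M [ - N ])
    where
    open ≡-Reasoning
    σ-alphabet-n : σ (alphabet n) ≡ alphabet m ++ N ∷ - M ∷ M ∷ - N ∷ []
    σ-alphabet-n = begin
      σ (alphabet n)                                         ≡⟨ cong σ alphabet-n ⟩
      σ (alphabet m ++ M ∷ - M ∷ N ∷ - N ∷ [])               ≡⟨ List.map-++ τ (alphabet m) _ ⟩
      σ (alphabet m) ++ τ M ∷ τ (- M) ∷ τ N ∷ τ (- N) ∷ []   ≡⟨ cong₂ _++_ (σ-clean alphabet-m-clean)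
        (cong₂ _∷_ τ-M (cong₂ _∷_ (τ-negative m) (cong₂ _∷_ τ-N (cong (_∷ []) (τ-negative (suc m)))))) ⟩
      alphabet m ++ N ∷ - M ∷ M ∷ - N ∷ []                   ∎

  module _ {c ℓ : Level} (R : CommutativeRing c ℓ) (s t : CommutativeRing.Carrier R) where

    open CommutativeRing R using (Carrier; _≈_; _*_; 0#; *-congʳ; reflexive; setoid; ring)
      renaming (sym to ≈-sym; -_ to -ᵣ_)
    open import Algebra.Properties.Ring ring using (-‿distribˡ-*)
    open import Relation.Binary.Reasoning.Setoid setoid
    open Sums R

    term : List ℤ → Carrier
    term w = signPow R (invD w) * (pow R s (ascB n w) * pow R t (desB w))

    term-σ : ∀ {w} → Separated w → term (σ w) ≈ -ᵣ term w
    term-σ {w} sep = begin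
      signPow R (invD (σ w)) * (pow R s (ascB n (σ w)) * pow R t (desB (σ w)))
        ≡⟨ cong (λ d → signPow R (invD (σ w)) * (pow R s (n ℕ.∸ d) * pow R t d)) (desB-σ sep) ⟩
      signPow R (invD (σ w)) * (pow R s (ascB n w) * pow R t (desB w))
        ≈⟨ *-congʳ (signPow-adjacent (invD-σ sep)) ⟩
      -ᵣ signPow R (invD w) * (pow R s (ascB n w) * pow R t (desB w))
        ≈⟨ ≈-sym (-‿distribˡ-* _ _) ⟩
      -ᵣ term w ∎

    D4Sum≈0 : D4Sum R n s t ≈ 0#
    D4Sum≈0 = begin
      ∑ term (filterᵇ (inD4 n) (filterᵇ distinctAbs W))
        ≈⟨ sumOver-filterᵇ term (inD4 n) (filterᵇ distinctAbs W) ⟩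
      ∑ (λ w → if inD4 n w then term w else 0#) (filterᵇ distinctAbs W)
        ≈⟨ sumOver-filterᵇ _ distinctAbs W ⟩
      ∑ (λ w → if distinctAbs w then (if inD4 n w then term w else 0#) else 0#) W
        ≈⟨ sumOver-cong (λ w → reflexive (sym (if-∧ (distinctAbs w)))) W ⟩
      ∑ (λ w → if isD4 w then term w else 0#) W
        ≈⟨ sumOver-signReversing W σ isD4 NbeforeM term (sumOver-words-map σ-alphabet n)
             (preserved-by-involution {p = isD4} {f = σ} σ-involutive isD4-σ)
             (λ w e → NbeforeM-σ (separated-isD4 w (Equivalence.from T-≡ e)))
             (λ w e → term-σ (separated-isD4 w (Equivalence.from T-≡ e))) ⟩
      0# ∎
      where
      W : List (List ℤ)
      W = words (alphabet n) n

lemma5p7 : {c ℓ : Level} (R : CommutativeRing c ℓ) (n : ℕ) → 3 ≤ n →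
    (s t : CommutativeRing.Carrier R) →
    CommutativeRing._≈_ R (D4Sum R n s t) (CommutativeRing.0# R)
lemma5p7 R (suc (suc m)) (s≤s (s≤s _)) s t = Transposition.D4Sum≈0 m R s t
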